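{- Let $A\subseteq\mathbb{Z}_{\geq0}^n$ be finite. For every $i\neq j$, $\pi_j(C_i(A))\subseteq C_i(\pi_j(A))$. In particular $|\pi_j(C_i(A))|\leq|\pi_j(A)|$.
   Context: $\pi_j$ deletes the $j$-th coordinate; elements of $\pi_j(\mathbb{Z}^n)$ keep the labels $1,\dots,j-1,j+1,\dots,n$ for their coordinates. For a finite set $A$ of integer vectors with coordinates labelled by an index set containing $i$, the $i$-th bottom layer is $B_i(A)=\{x\in A:$ whenever $y\in A$ with $y_k=x_k$ for all $k\neq i$, then $y_i\geq x_i\}$. For $A$ with nonnegative entries, the $i$-compression $C_i(A)$ is obtained from $A$ by replacing each $x\in B_i(A)$ by the vector obtained from $x$ by setting its $i$-labelled coordinate to $0$ (the other elements of $A$ are kept). In $C_i(\pi_j(A))$ the compression acts on the coordinate labelled $i$. -}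

module Defs where

open import Data.Bool using (Bool; true; false; not; _∨_; if_then_else_)
open import Data.Nat using (ℕ; suc; _≤ᵇ_; _≟_)
open import Data.Fin using (Fin; punchOut)
open import Data.Vec using (Vec; lookup; removeAt; _[_]≔_)
open import Data.Vec.Properties using (≡-dec)
open import Data.List using (List; map; length; deduplicate)
open import Data.Bool.ListAction using (and)
open import Relation.Nullary using (does)
open import Relation.Binary.PropositionalEquality using (_≢_)

-- A finite subset of ℤ_{≥0}^n is represented by a list of vectors
-- (set semantics: membership _∈_; duplicates are irrelevant).
FinSet : ℕ → Set
FinSet n = List (Vec ℕ n)

card : ∀ {n} → FinSet n → ℕ
card A = length (deduplicate (≡-dec _≟_) A)

π : ∀ {n} → Fin (suc n) → Vec ℕ (suc n) → Vec ℕ n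
π j x = removeAt x j

πS : ∀ {n} → Fin (suc n) → FinSet (suc n) → FinSet n
πS j A = map (π j) A

sameExcept : ∀ {n} → Fin n → Vec ℕ n → Vec ℕ n → Bool
sameExcept i x y = does (≡-dec _≟_ (x [ i ]≔ 0) (y [ i ]≔ 0))

isBottom : ∀ {n} → Fin n → FinSet n → Vec ℕ n → Bool
isBottom i A x = and (map (λ y → not (sameExcept i x y) ∨ (lookup x i ≤ᵇ lookup y i)) A)

C : ∀ {n} → Fin n → FinSet n → FinSet n
C i A = map (λ x → if isBottom i A x then x [ i ]≔ 0 else x) A

-- label i in π_j(ℤ^{n+1}) corresponds to position punchOut (j ≢ i)
relabel : ∀ {n} {j i : Fin (suc n)} → j ≢ i → Fin n
relabel j≢i = punchOut j≢i

-- π_j maps each i-fibre of A (points agreeing off coordinate i) into an i-fibre of π_j(A)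
-- and keeps the i-th coordinate, so a point with a lower point in its fibre keeps one after
-- projection: non-bottom points of A project to non-bottom points of π_j(A), which the
-- compression keeps. A bottom point x is compressed to x with x_i = 0, and its projection
-- is the compressed image of the bottom point of the fibre of π_j(x) in π_j(A). The
-- cardinality bound follows because a compression is the image of a map.
module Submission where

open import Defs
open import Data.Bool using (true; false; T; not; _∨_; if_then_else_)
open import Data.Bool.Properties using (T?)
open import Data.Fin using (Fin; zero; suc; punchOut)
open import Data.List using (List; []; _∷_; map; length; deduplicate)
open import Data.List.Properties using (length-map)
open import Data.List.Membership.Propositional using (_∈_; find)
open import Data.List.Membership.Propositional.Properties
  using (∈-map⁺; ∈-map⁻; ∈-deduplicate⁺; ∈-deduplicate⁻)
open import Data.List.Relation.Binary.Subset.Propositional using (_⊆_)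
import Data.List.Relation.Unary.All as All
open import Data.List.Relation.Unary.All.Properties using (all⁺; all⁻; ¬All⇒Any¬)
open import Data.List.Relation.Unary.Any using (here; there)
open import Data.List.Relation.Unary.AllPairs using ([]; _∷_)
open import Data.List.Relation.Unary.Unique.Propositional using (Unique)
open import Data.List.Relation.Unary.Unique.DecPropositional.Properties using (deduplicate-!)
open import Data.Nat using (ℕ; suc; _≤_; _<_; _≤ᵇ_; _≟_; z≤n; s≤s)
open import Data.Nat.Induction using (<-wellFounded)
open import Data.Nat.Properties using (≤ᵇ⇒≤; ≤⇒≤ᵇ; <⇒≱; ≰⇒>; ≤-trans; ≤-reflexive)
open import Data.Product using (_×_; _,_; ∃)
open import Data.Vec using (Vec; _∷_; lookup; removeAt; _[_]≔_)
open import Data.Vec.Properties using (≡-dec; removeAt-punchOut)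
open import Function using (_∘_)
open import Induction.WellFounded using (Acc; acc)
open import Relation.Nullary using (¬_; yes; no; contradiction)
open import Relation.Nullary.Decidable using (dec-true)
open import Relation.Binary.Definitions using (DecidableEquality)
open import Relation.Binary.PropositionalEquality using (_≡_; _≢_; refl; sym; trans; cong; subst; subst₂; module ≡-Reasoning)

removeAt-[]≔ : ∀ {A : Set} {n} (x : Vec A (suc n)) {j i : Fin (suc n)} (j≢i : j ≢ i) (v : A) →
               removeAt (x [ i ]≔ v) j ≡ removeAt x j [ punchOut j≢i ]≔ v
removeAt-[]≔ (x ∷ xs)     {zero}  {zero}      j≢i v = contradiction refl j≢i
removeAt-[]≔ (x ∷ xs)     {zero}  {suc i}     j≢i v = refl
removeAt-[]≔ (x ∷ y ∷ xs) {suc j} {zero}      j≢i v = refl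
removeAt-[]≔ (x ∷ y ∷ xs) {suc j} {suc zero}   j≢i v =
  cong (x ∷_) (removeAt-[]≔ (y ∷ xs) (j≢i ∘ cong suc) v)
removeAt-[]≔ (x ∷ y ∷ xs) {suc j} {suc (suc i)} j≢i v =
  cong (x ∷_) (removeAt-[]≔ (y ∷ xs) (j≢i ∘ cong suc) v)

module _ {A : Set} where

  remove : ∀ {x : A} (ys : List A) → x ∈ ys → List A
  remove (y ∷ ys) (here _)  = ys
  remove (y ∷ ys) (there p) = y ∷ remove ys p

  length-remove : ∀ {x : A} (ys : List A) (p : x ∈ ys) → suc (length (remove ys p)) ≡ length ys
  length-remove (y ∷ ys) (here _)  = refl
  length-remove (y ∷ ys) (there p) = cong suc (length-remove ys p)

  ∈-remove : ∀ {x z : A} (ys : List A) → z ∈ ys → z ≢ x → (p : x ∈ ys) → z ∈ remove ys p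
  ∈-remove (y ∷ ys) (here refl) z≢x (here refl) = contradiction refl z≢x
  ∈-remove (y ∷ ys) (here z≡y)  z≢x (there p)   = here z≡y
  ∈-remove (y ∷ ys) (there z∈)  z≢x (here _)    = z∈
  ∈-remove (y ∷ ys) (there z∈)  z≢x (there p)   = there (∈-remove ys z∈ z≢x p)

  Unique-⊆⇒length-≤ : ∀ {xs ys : List A} → Unique xs → xs ⊆ ys → length xs ≤ length ys
  Unique-⊆⇒length-≤ {[]}     []             _     = z≤n
  Unique-⊆⇒length-≤ {x ∷ xs} {ys} (x∉xs ∷ u) xs⊆ys = ≤-trans
    (s≤s (Unique-⊆⇒length-≤ u λ z∈ →
      ∈-remove ys (xs⊆ys (there z∈)) (λ z≡x → All.lookup x∉xs z∈ (sym z≡x)) x∈ys))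
    (≤-reflexive (length-remove ys x∈ys))
    where x∈ys = xs⊆ys (here refl)

private
  _≟ᵥ_ : ∀ {n} → DecidableEquality (Vec ℕ n)
  _≟ᵥ_ = ≡-dec _≟_

module _ {n : ℕ} where

  card-mono : ∀ {A B : FinSet n} → A ⊆ B → card A ≤ card B
  card-mono {A} A⊆B = Unique-⊆⇒length-≤ (deduplicate-! _≟ᵥ_ A)
    (∈-deduplicate⁺ _≟ᵥ_ ∘ A⊆B ∘ ∈-deduplicate⁻ _≟ᵥ_ A)

  card-map : ∀ {m} (h : Vec ℕ n → Vec ℕ m) (A : FinSet n) → card (map h A) ≤ card A
  card-map h A = ≤-trans
    (Unique-⊆⇒length-≤ (deduplicate-! _≟ᵥ_ (map h A)) image⊆)
    (≤-reflexive (length-map h (deduplicate _≟ᵥ_ A)))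
    where
    image⊆ : deduplicate _≟ᵥ_ (map h A) ⊆ map h (deduplicate _≟ᵥ_ A)
    image⊆ z∈ with ∈-map⁻ h (∈-deduplicate⁻ _≟ᵥ_ (map h A) z∈)
    ... | x , x∈ , refl = ∈-map⁺ h (∈-deduplicate⁺ _≟ᵥ_ x∈)

module _ {n : ℕ} (i : Fin n) (A : FinSet n) where

  Below : Vec ℕ n → Vec ℕ n → Set
  Below y x = y ∈ A × x [ i ]≔ 0 ≡ y [ i ]≔ 0 × lookup y i < lookup x i

  private
    sameExcept-≡ : ∀ {x y} → x [ i ]≔ 0 ≡ y [ i ]≔ 0 → sameExcept i x y ≡ true
    sameExcept-≡ = dec-true (_ ≟ᵥ _)

  isBottom⇒¬Below : ∀ {x y} → T (isBottom i A x) → ¬ Below y x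
  isBottom⇒¬Below {x} {y} bottom (y∈ , same , y<x) = <⇒≱ y<x (≤ᵇ⇒≤ _ _ x≤ᵇy)
    where
    x≤ᵇy : T (lookup x i ≤ᵇ lookup y i)
    x≤ᵇy = subst (λ b → T (not b ∨ (lookup x i ≤ᵇ lookup y i))) (sameExcept-≡ same)
             (All.lookup (all⁺ _ A bottom) y∈)

  ¬isBottom⇒Below : ∀ {x} → ¬ T (isBottom i A x) → ∃ λ y → Below y x
  ¬isBottom⇒Below {x} ¬bottom with find (¬All⇒Any¬ (T? ∘ _) A (¬bottom ∘ all⁻ _))
  ... | y , y∈ , ¬minimal with (x [ i ]≔ 0) ≟ᵥ (y [ i ]≔ 0)
  ...   | yes same = y , y∈ , same , ≰⇒> (¬minimal ∘ ≤⇒≤ᵇ)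
  ...   | no _     = contradiction _ ¬minimal

  ∃-bottom : ∀ {u} → u ∈ A → ∃ λ w → w ∈ A × u [ i ]≔ 0 ≡ w [ i ]≔ 0 × T (isBottom i A w)
  ∃-bottom u∈ = descend u∈ (<-wellFounded _)
    where
    descend : ∀ {u} → u ∈ A → Acc _<_ (lookup u i) →
              ∃ λ w → w ∈ A × u [ i ]≔ 0 ≡ w [ i ]≔ 0 × T (isBottom i A w)
    descend {u} u∈ (acc rs) with T? (isBottom i A u)
    ... | yes bottom = u , u∈ , refl , bottom
    ... | no ¬bottom with ¬isBottom⇒Below ¬bottom
    ...   | y , y∈ , same , y<u with descend y∈ (rs y<u)
    ...     | w , w∈ , same′ , bottom = w , w∈ , trans same same′ , bottom

  compress : Vec ℕ n → Vec ℕ n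
  compress x = if isBottom i A x then x [ i ]≔ 0 else x

  compress-elim : ∀ {x} (P : Vec ℕ n → Set) →
                  (T (isBottom i A x) → P (x [ i ]≔ 0)) → (¬ T (isBottom i A x) → P x) →
                  P (compress x)
  compress-elim {x} P bottom-case other-case with isBottom i A x
  ... | true  = bottom-case _
  ... | false = other-case λ ()

  bottom-∈-C : ∀ {x} → x ∈ A → T (isBottom i A x) → x [ i ]≔ 0 ∈ C i A
  bottom-∈-C {x} x∈ bottom with isBottom i A x | ∈-map⁺ compress x∈
  ... | true | c∈ = c∈

  nonBottom-∈-C : ∀ {x} → x ∈ A → ¬ T (isBottom i A x) → x ∈ C i A
  nonBottom-∈-C {x} x∈ ¬bottom with isBottom i A x | ∈-map⁺ compress x∈
  ... | true  | _  = contradiction _ ¬bottom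
  ... | false | c∈ = c∈

module _ {n : ℕ} (A : FinSet (suc n)) {i j : Fin (suc n)} (j≢i : j ≢ i) where

  private
    i′ : Fin n
    i′ = relabel j≢i

    B : FinSet n
    B = πS j A

  π-[]≔ : ∀ x → π j (x [ i ]≔ 0) ≡ π j x [ i′ ]≔ 0
  π-[]≔ x = removeAt-[]≔ x j≢i 0

  π-Below : ∀ {x y} → Below i A y x → Below i′ B (π j y) (π j x)
  π-Below {x} {y} (y∈ , same , y<x) =
    ∈-map⁺ (π j) y∈ ,
    (begin
      π j x [ i′ ]≔ 0    ≡⟨ sym (π-[]≔ x) ⟩
      π j (x [ i ]≔ 0)   ≡⟨ cong (π j) same ⟩
      π j (y [ i ]≔ 0)   ≡⟨ π-[]≔ y ⟩
      π j y [ i′ ]≔ 0    ∎) ,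
    subst₂ _<_ (sym (removeAt-punchOut y j≢i)) (sym (removeAt-punchOut x j≢i)) y<x
    where open ≡-Reasoning

  π-bottom-∈-C : ∀ {x} → x ∈ A → π j (x [ i ]≔ 0) ∈ C i′ B
  π-bottom-∈-C {x} x∈ with ∃-bottom i′ B (∈-map⁺ (π j) x∈)
  ... | w , w∈ , same , bottom =
    subst (_∈ C i′ B) (sym (trans (π-[]≔ x) same)) (bottom-∈-C i′ B w∈ bottom)

  π-nonBottom-∈-C : ∀ {x} → x ∈ A → ¬ T (isBottom i A x) → π j x ∈ C i′ B
  π-nonBottom-∈-C {x} x∈ ¬bottom with ¬isBottom⇒Below i A {x} ¬bottom
  ... | y , below = nonBottom-∈-C i′ B (∈-map⁺ (π j) x∈)
                      λ bottom → isBottom⇒¬Below i′ B bottom (π-Below below)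

  πS-C-⊆ : πS j (C i A) ⊆ C i′ B
  πS-C-⊆ z∈ with ∈-map⁻ (π j) z∈
  ... | c , c∈ , refl with ∈-map⁻ (compress i A) c∈
  ... | x , x∈ , refl =
    compress-elim i A {x} (λ c → π j c ∈ C i′ B) (λ _ → π-bottom-∈-C x∈) (π-nonBottom-∈-C x∈)

lemma6 : (n : ℕ) (A : FinSet (suc n)) (i j : Fin (suc n)) (j≢i : j ≢ i) →
    (∀ (z : Vec ℕ n) → z ∈ πS j (C i A) → z ∈ C (relabel j≢i) (πS j A))
    × card (πS j (C i A)) ≤ card (πS j A)
lemma6 n A i j j≢i =
  (λ _ → πS-C-⊆ A j≢i) ,
  ≤-trans (card-mono (πS-C-⊆ A j≢i)) (card-map _ (πS j A))
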